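{- For every integer $m\ge 1$, let $P_m=\{(i,\sqrt2\,j): i,j\in\mathbb{Z},\ 0\le i,j\le m-1\}\subset\mathbb{R}^2$. Then every $4$-point subset of $P_m$ determines at least $3$ distinct pairwise Euclidean distances. -}

module Defs where

open import Data.Nat using (ℕ; _+_; _*_; _∸_)
open import Data.Nat.Properties using (_≟_)
open import Data.Fin using (Fin; toℕ)
open import Data.Product using (_×_; _,_)
open import Data.List using (List; []; _∷_; length; deduplicate)

-- A point of P_m = {(i, √2 j) : 0 ≤ i, j ≤ m-1} is represented by its
-- integer coordinates (i , j) ∈ Fin m × Fin m.
Point : ℕ → Set
Point m = Fin m × Fin m

dist : ℕ → ℕ → ℕ
dist a b = (a ∸ b) + (b ∸ a)

-- Squared Euclidean distance between (i, √2 j) and (i', √2 j'):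
-- (i - i')² + 2 (j - j')²  (a natural number).
-- Since the Euclidean distance is the nonnegative square root of this,
-- two distances are equal iff their squares are equal.
sqDist : ∀ {m} → Point m → Point m → ℕ
sqDist (i , j) (i' , j') =
  let di = dist (toℕ i) (toℕ i')
      dj = dist (toℕ j) (toℕ j')
  in di * di + 2 * (dj * dj)

pairwiseSqDists : ∀ {m} → Point m → Point m → Point m → Point m → List ℕ
pairwiseSqDists p q r s =
  sqDist p q ∷ sqDist p r ∷ sqDist p s ∷ sqDist q r ∷ sqDist q s ∷ sqDist r s ∷ []

numDistinctDists : ∀ {m} → Point m → Point m → Point m → Point m → ℕ
numDistinctDists p q r s = length (deduplicate _≟_ (pairwiseSqDists p q r s))

{-# OPTIONS --safe #-}
module Submission where

-- If four points determined only two distances,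
-- the edges of K₄ would be 2-coloured by them, and such a colouring contains
-- a monochromatic triangle, a 4-cycle whose diagonals have the other colour,
-- or a path of length 3 whose complementary path has the other colour.  So
-- the points would contain an equilateral triangle, a square, or four
-- vertices of a regular pentagon.  By Heron's formula 16·area² = 8k² for an
-- integer k, and four points of the plane have vanishing Cayley–Menger
-- determinant; for the three configurations these identities produce
-- (4k)² = 6a², (4k)² = 2b² and (2b − 3a)² = 5a² respectively, which the
-- irrationality of √6, √2 and √5 (by descent) rules out.

open import Defs
open import Data.Empty using (⊥)
open import Data.Nat using (ℕ; zero; suc; _≤_; s≤s)
open import Data.Nat.Properties using (_≟_; _≤?_; ≤-pred; ≰⇒>)
open import Data.Product using (_×_; ∃₂; _,_)
open import Data.Sum using (_⊎_; inj₁; inj₂)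
open import Data.List using ([]; _∷_; length; deduplicate)
open import Data.List.Membership.Propositional using (_∈_)
open import Data.List.Membership.Propositional.Properties using (∈-deduplicate⁺)
open import Data.List.Relation.Unary.All using (All; []; _∷_; tabulate)
open import Data.List.Relation.Unary.Any using (here; there)
open import Relation.Binary.Definitions using (DecidableEquality)
open import Relation.Binary.PropositionalEquality using (_≡_; _≢_; refl; trans)
open import Relation.Nullary.Decidable using (decidable-stable)

TwoValued : ∀ {A : Set} → A → A → A → Set
TwoValued a b c = c ≡ a ⊎ c ≡ b

module Irrationality where

  open import Data.Nat
  open import Data.Nat.Properties
  open import Data.Nat.Divisibility using (_∣_; divides; ∣-trans)
  open import Data.Nat.Primality using (Prime; prime?; prime[2]; euclidsLemma)
  open import Data.Nat.LCM using (lcm; m∣lcm[m,n]; n∣lcm[m,n]; lcm-least)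
  open import Data.Nat.Induction using (<-wellFounded)
  open import Data.Nat.Tactic.RingSolver using (solve-∀)
  open import Data.Integer as ℤ using (ℤ; +_)
  open import Data.Integer.Properties using (abs-*)
  open import Data.Sum using ([_,_]′)
  open import Function using (id)
  open import Induction.WellFounded using (Acc; acc)
  open import Relation.Binary.PropositionalEquality
  open import Relation.Nullary.Decidable using (from-yes)

  -- For n ≥ 1 this is equivalent to n being squarefree.
  Squarefree : ℕ → Set
  Squarefree n = ∀ x → n ∣ x * x → n ∣ x

  prime⇒squarefree : ∀ {p} → Prime p → Squarefree p
  prime⇒squarefree p-prime x p∣x*x = [ id , id ]′ (euclidsLemma x x p-prime p∣x*x)

  squarefree-lcm : ∀ {m n} → Squarefree m → Squarefree n → Squarefree (lcm m n)
  squarefree-lcm {m} {n} sf-m sf-n x lcm∣x*x = lcm-least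
    (sf-m x (∣-trans (m∣lcm[m,n] m n) lcm∣x*x))
    (sf-n x (∣-trans (n∣lcm[m,n] m n) lcm∣x*x))

  squarefree-2 : Squarefree 2
  squarefree-2 = prime⇒squarefree prime[2]

  squarefree-5 : Squarefree 5
  squarefree-5 = prime⇒squarefree (from-yes (prime? 5))

  squarefree-6 : Squarefree 6
  squarefree-6 = squarefree-lcm squarefree-2 (prime⇒squarefree (from-yes (prime? 3)))

  module _ {n : ℕ} .{{_ : NonTrivial n}} (sf : Squarefree n) where

    private instance
      n≢0 : NonZero n
      n≢0 = nonTrivial⇒nonZero n

    [a*n]²≡n*b⇒b≡n*a² : ∀ a b → a * n * (a * n) ≡ n * b → b ≡ n * (a * a)
    [a*n]²≡n*b⇒b≡n*a² a b eq = *-cancelˡ-≡ b (n * (a * a)) n (trans (sym eq) (expand a n))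
      where
      expand : ∀ a n → a * n * (a * n) ≡ n * (n * (a * a))
      expand = solve-∀

    x*x≡n*[y*y]-descent : ∀ {x y} → x * x ≡ n * (y * y) →
                          ∃₂ λ x′ y′ → y ≡ y′ * n × x′ * x′ ≡ n * (y′ * y′)
    x*x≡n*[y*y]-descent {x} {y} eq with sf x (divides (y * y) (trans eq (*-comm n (y * y))))
    ... | divides x′ refl with [a*n]²≡n*b⇒b≡n*a² x′ (y * y) eq
    ... | y*y≡n*[x′*x′] with sf y (divides (x′ * x′) (trans y*y≡n*[x′*x′] (*-comm n (x′ * x′))))
    ... | divides y′ refl = x′ , y′ , refl , [a*n]²≡n*b⇒b≡n*a² y′ (x′ * x′) y*y≡n*[x′*x′]

    x*x≡n*[y*y]⇒y≡0 : ∀ x y → x * x ≡ n * (y * y) → y ≡ 0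
    x*x≡n*[y*y]⇒y≡0 x y = descent x y (<-wellFounded y)
      where
      descent : ∀ x y → Acc _<_ y → x * x ≡ n * (y * y) → y ≡ 0
      descent x y (acc smaller) eq with x*x≡n*[y*y]-descent {x} {y} eq
      ... | _ , zero , refl , _ = refl
      ... | x′ , y′@(suc _) , refl , eq′ =
        cong (_* n) (descent x′ y′ (smaller (m<m*n y′ n (nonTrivial⇒n>1 n))) eq′)

    x*x≡n*[y*y]⇒∣y∣≡0 : ∀ (x y : ℤ) → x ℤ.* x ≡ + n ℤ.* (y ℤ.* y) → ℤ.∣ y ∣ ≡ 0
    x*x≡n*[y*y]⇒∣y∣≡0 x y eq = x*x≡n*[y*y]⇒y≡0 ℤ.∣ x ∣ ℤ.∣ y ∣ (begin
      ℤ.∣ x ∣ * ℤ.∣ x ∣            ≡⟨ abs-* x x ⟨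
      ℤ.∣ x ℤ.* x ∣                ≡⟨ cong ℤ.∣_∣ eq ⟩
      ℤ.∣ + n ℤ.* (y ℤ.* y) ∣      ≡⟨ abs-* (+ n) (y ℤ.* y) ⟩
      n * ℤ.∣ y ℤ.* y ∣            ≡⟨ cong (n *_) (abs-* y y) ⟩
      n * (ℤ.∣ y ∣ * ℤ.∣ y ∣)      ∎)
      where open ≡-Reasoning

module PlaneAlgebra where

  open import Data.Integer
  open import Data.Integer.Properties using (i*j≡0⇒i≡0∨j≡0; i-j≡0⇒i≡j; +-identityʳ)
  open import Data.Integer.Tactic.RingSolver using (solve-∀)
  open import Data.Sum as Sum using ([_,_]′)
  open import Function using (id)
  open import Relation.Binary.PropositionalEquality

  -- The definitions below are INLINE so that solve-∀ sees through them.

  -- Squared Euclidean length of the vector (a, √2 b).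
  ‖_,_‖² : ℤ → ℤ → ℤ
  ‖ a , b ‖² = a * a + + 2 * (b * b)
  {-# INLINE ‖_,_‖² #-}

  -- Sixteen times the squared area of a triangle with squared side lengths a, b, c.
  heron : ℤ → ℤ → ℤ → ℤ
  heron a b c = + 4 * (a * b) - (a + b - c) * (a + b - c)
  {-# INLINE heron #-}

  symDet₃ : ℤ → ℤ → ℤ → ℤ → ℤ → ℤ → ℤ
  symDet₃ a b c u v w = a * (b * c - w * w) - u * (u * c - v * w) + v * (u * w - b * v)
  {-# INLINE symDet₃ #-}

  -- For the squared distances dᵢⱼ of points P₀, …, P₃: the determinant of the Gram matrix
  -- (2 ⟨Pᵢ − P₀, Pⱼ − P₀⟩)ᵢⱼ, using 2 ⟨u, v⟩ = |u|² + |v|² − |u − v|².  Up to a constant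
  -- factor this is the Cayley–Menger determinant.
  cayleyMenger : ℤ → ℤ → ℤ → ℤ → ℤ → ℤ → ℤ
  cayleyMenger d₀₁ d₀₂ d₀₃ d₁₂ d₁₃ d₂₃ =
    symDet₃ (+ 2 * d₀₁) (+ 2 * d₀₂) (+ 2 * d₀₃) (d₀₁ + d₀₂ - d₁₂) (d₀₁ + d₀₃ - d₁₃) (d₀₂ + d₀₃ - d₂₃)
  {-# INLINE cayleyMenger #-}

  det₂ : ℤ → ℤ → ℤ → ℤ → ℤ
  det₂ a b c d = a * d - b * c
  {-# INLINE det₂ #-}

  heron-lattice : ∀ x₀ y₀ x₁ y₁ x₂ y₂ →
    let k = det₂ (x₁ - x₀) (y₁ - y₀) (x₂ - x₀) (y₂ - y₀) in
    heron ‖ x₀ - x₁ , y₀ - y₁ ‖² ‖ x₀ - x₂ , y₀ - y₂ ‖² ‖ x₁ - x₂ , y₁ - y₂ ‖² ≡ + 8 * (k * k)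
  heron-lattice = solve-∀

  cayleyMenger-lattice : ∀ x₀ y₀ x₁ y₁ x₂ y₂ x₃ y₃ →
    cayleyMenger ‖ x₀ - x₁ , y₀ - y₁ ‖² ‖ x₀ - x₂ , y₀ - y₂ ‖² ‖ x₀ - x₃ , y₀ - y₃ ‖²
                 ‖ x₁ - x₂ , y₁ - y₂ ‖² ‖ x₁ - x₃ , y₁ - y₃ ‖² ‖ x₂ - x₃ , y₂ - y₃ ‖² ≡ 0ℤ
  cayleyMenger-lattice = solve-∀

  [4*k]²≡2*[8*k²] : ∀ k → (+ 4 * k) * (+ 4 * k) ≡ + 2 * (+ 8 * (k * k))
  [4*k]²≡2*[8*k²] = solve-∀

  equilateral-heron : ∀ a k → heron a a a ≡ + 8 * (k * k) → (+ 4 * k) * (+ 4 * k) ≡ + 6 * (a * a)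
  equilateral-heron a k area = begin
    (+ 4 * k) * (+ 4 * k)  ≡⟨ [4*k]²≡2*[8*k²] k ⟩
    + 2 * (+ 8 * (k * k))  ≡⟨ cong (+ 2 *_) area ⟨
    + 2 * heron a a a      ≡⟨ collect a ⟩
    + 6 * (a * a)          ∎
    where
    open ≡-Reasoning
    collect : ∀ a → + 2 * heron a a a ≡ + 6 * (a * a)
    collect = solve-∀

  square-cayleyMenger : ∀ a b → cayleyMenger a b a a b a ≡ (b * b) * (+ 4 * (+ 2 * a - b))
  square-cayleyMenger = solve-∀

  square-diagonal : ∀ a b → cayleyMenger a b a a b a ≡ 0ℤ → b ≡ 0ℤ ⊎ b ≡ + 2 * a
  square-diagonal a b cm≡0 =
    Sum.map (λ b*b≡0 → [ id , id ]′ (i*j≡0⇒i≡0∨j≡0 b b*b≡0))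
            (λ 4[2a-b]≡0 → sym (i-j≡0⇒i≡j (+ 2 * a) b ([ (λ ()) , id ]′ (i*j≡0⇒i≡0∨j≡0 (+ 4) 4[2a-b]≡0))))
            (i*j≡0⇒i≡0∨j≡0 (b * b) (trans (sym (square-cayleyMenger a b)) cm≡0))

  square-heron : ∀ a b k → b ≡ + 2 * a → heron a b a ≡ + 8 * (k * k) →
                 (+ 4 * k) * (+ 4 * k) ≡ + 2 * (b * b)
  square-heron a _ k refl area = begin
    (+ 4 * k) * (+ 4 * k)          ≡⟨ [4*k]²≡2*[8*k²] k ⟩
    + 2 * (+ 8 * (k * k))          ≡⟨ cong (+ 2 *_) area ⟨
    + 2 * heron a (+ 2 * a) a      ≡⟨ collect a ⟩
    + 2 * ((+ 2 * a) * (+ 2 * a))  ∎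
    where
    open ≡-Reasoning
    collect : ∀ a → + 2 * heron a (+ 2 * a) a ≡ + 2 * ((+ 2 * a) * (+ 2 * a))
    collect = solve-∀

  pentagon-cayleyMenger : ∀ a b →
    cayleyMenger a b b a b a ≡ (a + b) * (+ 2 * (+ 3 * (a * b) - a * a - b * b))
  pentagon-cayleyMenger = solve-∀

  -- b / a is the square of the golden ratio.
  pentagon-diagonal : ∀ a b → cayleyMenger a b b a b a ≡ 0ℤ →
                      a + b ≡ 0ℤ ⊎ (+ 2 * b - + 3 * a) * (+ 2 * b - + 3 * a) ≡ + 5 * (a * a)
  pentagon-diagonal a b cm≡0 =
    Sum.map₂ golden (i*j≡0⇒i≡0∨j≡0 (a + b) (trans (sym (pentagon-cayleyMenger a b)) cm≡0))
    where
    open ≡-Reasoning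
    q = + 2 * (+ 3 * (a * b) - a * a - b * b)
    complete-square : ∀ a b → (+ 2 * b - + 3 * a) * (+ 2 * b - + 3 * a)
                              ≡ + 5 * (a * a) - + 2 * (+ 2 * (+ 3 * (a * b) - a * a - b * b))
    complete-square = solve-∀
    golden : q ≡ 0ℤ → (+ 2 * b - + 3 * a) * (+ 2 * b - + 3 * a) ≡ + 5 * (a * a)
    golden q≡0 = begin
      (+ 2 * b - + 3 * a) * (+ 2 * b - + 3 * a)  ≡⟨ complete-square a b ⟩
      + 5 * (a * a) - + 2 * q                    ≡⟨ cong (λ t → + 5 * (a * a) - + 2 * t) q≡0 ⟩
      + 5 * (a * a) - + 2 * 0ℤ                   ≡⟨ +-identityʳ (+ 5 * (a * a)) ⟩
      + 5 * (a * a)                              ∎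

module LatticeGeometry {m : ℕ} where

  open import Data.Nat as ℕ using (_∸_)
  open import Data.Nat.Properties
    using (+-identityʳ; +-comm; ≤-antisym; m∸n≡0⇒m≤n; m+n≡0⇒m≡0; m+n≡0⇒n≡0; m*n≡0⇒m≡0∨n≡0)
  open import Data.Integer
    using (ℤ; +_; -[1+_]; 0ℤ; _+_; _-_; _*_; _⊖_; ∣_∣)
  open import Data.Integer.Properties
    using (pos-+; pos-*; [1+m]⊖[1+n]≡m⊖n; [+m]-[+n]≡m⊖n; +-injective)
  open import Data.Fin using (toℕ)
  open import Data.Fin.Properties using (toℕ-injective)
  open import Data.Product using (∃; proj₁; proj₂)
  open import Data.Sum using ([_,_]′)
  open import Function using (id)
  open import Function.Nary.NonDependent using (congₙ)
  open import Relation.Binary.PropositionalEquality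
  open Irrationality
  open PlaneAlgebra

  X Y : Point m → ℤ
  X P = + toℕ (proj₁ P)
  Y P = + toℕ (proj₂ P)

  dist-comm : ∀ a b → dist a b ≡ dist b a
  dist-comm a b = +-comm (a ∸ b) (b ∸ a)

  dist≡0⇒≡ : ∀ {a b} → dist a b ≡ 0 → a ≡ b
  dist≡0⇒≡ {a} {b} d≡0 =
    ≤-antisym (m∸n≡0⇒m≤n (m+n≡0⇒m≡0 (a ∸ b) d≡0)) (m∸n≡0⇒m≤n (m+n≡0⇒n≡0 (a ∸ b) d≡0))

  dist≡∣⊖∣ : ∀ a b → dist a b ≡ ∣ a ⊖ b ∣
  dist≡∣⊖∣ zero    zero    = refl
  dist≡∣⊖∣ zero    (suc b) = refl
  dist≡∣⊖∣ (suc a) zero    = +-identityʳ (suc a)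
  dist≡∣⊖∣ (suc a) (suc b) = trans (dist≡∣⊖∣ a b) (cong ∣_∣ (sym ([1+m]⊖[1+n]≡m⊖n a b)))

  ∣i∣*∣i∣≡i*i : ∀ i → + ∣ i ∣ * + ∣ i ∣ ≡ i * i
  ∣i∣*∣i∣≡i*i (+ _)      = refl
  ∣i∣*∣i∣≡i*i -[1+ _ ] = refl

  +[dist*dist] : ∀ a b → + (dist a b ℕ.* dist a b) ≡ (+ a - + b) * (+ a - + b)
  +[dist*dist] a b = begin
    + (dist a b ℕ.* dist a b)    ≡⟨ cong (λ d → + (d ℕ.* d)) (dist≡∣⊖∣ a b) ⟩
    + (∣ a ⊖ b ∣ ℕ.* ∣ a ⊖ b ∣)  ≡⟨ pos-* ∣ a ⊖ b ∣ ∣ a ⊖ b ∣ ⟩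
    + ∣ a ⊖ b ∣ * + ∣ a ⊖ b ∣    ≡⟨ ∣i∣*∣i∣≡i*i (a ⊖ b) ⟩
    (a ⊖ b) * (a ⊖ b)            ≡⟨ cong (λ i → i * i) ([+m]-[+n]≡m⊖n a b) ⟨
    (+ a - + b) * (+ a - + b)    ∎
    where open ≡-Reasoning

  +sqDist≡‖‖² : ∀ (P Q : Point m) → + sqDist P Q ≡ ‖ X P - X Q , Y P - Y Q ‖²
  +sqDist≡‖‖² (i , j) (i′ , j′) = begin
    + (dᵢ ℕ.* dᵢ ℕ.+ 2 ℕ.* (dⱼ ℕ.* dⱼ))    ≡⟨ pos-+ (dᵢ ℕ.* dᵢ) (2 ℕ.* (dⱼ ℕ.* dⱼ)) ⟩
    + (dᵢ ℕ.* dᵢ) + + (2 ℕ.* (dⱼ ℕ.* dⱼ))  ≡⟨ cong₂ _+_ (+[dist*dist] (toℕ i) (toℕ i′))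
                                                  (trans (pos-* 2 (dⱼ ℕ.* dⱼ))
                                                         (cong (+ 2 *_) (+[dist*dist] (toℕ j) (toℕ j′)))) ⟩
    ‖ X (i , j) - X (i′ , j′) , Y (i , j) - Y (i′ , j′) ‖² ∎
    where
    open ≡-Reasoning
    dᵢ = dist (toℕ i) (toℕ i′)
    dⱼ = dist (toℕ j) (toℕ j′)

  sqDist-sym : ∀ (P Q : Point m) → sqDist P Q ≡ sqDist Q P
  sqDist-sym (i , j) (i′ , j′) rewrite dist-comm (toℕ i) (toℕ i′) | dist-comm (toℕ j) (toℕ j′) = refl

  sqDist≡0⇒≡ : ∀ {P Q : Point m} → sqDist P Q ≡ 0 → P ≡ Q
  sqDist≡0⇒≡ {i , j} {i′ , j′} sq≡0 = cong₂ _,_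
    (toℕ-injective (dist≡0⇒≡ (n*n≡0⇒n≡0 (m+n≡0⇒m≡0 (dᵢ ℕ.* dᵢ) sq≡0))))
    (toℕ-injective (dist≡0⇒≡ (n*n≡0⇒n≡0 (m+n≡0⇒m≡0 (dⱼ ℕ.* dⱼ) (m+n≡0⇒n≡0 (dᵢ ℕ.* dᵢ) sq≡0)))))
    where
    dᵢ = dist (toℕ i) (toℕ i′)
    dⱼ = dist (toℕ j) (toℕ j′)
    n*n≡0⇒n≡0 : ∀ {n} → n ℕ.* n ≡ 0 → n ≡ 0
    n*n≡0⇒n≡0 {n} n*n≡0 = [ id , id ]′ (m*n≡0⇒m≡0∨n≡0 n n*n≡0)

  heron-sqDist : ∀ (P Q R : Point m) {a b c} → sqDist P Q ≡ a → sqDist P R ≡ b → sqDist Q R ≡ c →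
                 ∃ λ k → heron (+ a) (+ b) (+ c) ≡ + 8 * (k * k)
  heron-sqDist P Q R refl refl refl = det₂ (X Q - X P) (Y Q - Y P) (X R - X P) (Y R - Y P) ,
    trans (congₙ 3 heron (+sqDist≡‖‖² P Q) (+sqDist≡‖‖² P R) (+sqDist≡‖‖² Q R))
          (heron-lattice (X P) (Y P) (X Q) (Y Q) (X R) (Y R))

  cayleyMenger-sqDist : ∀ (P₀ P₁ P₂ P₃ : Point m) {d₀₁ d₀₂ d₀₃ d₁₂ d₁₃ d₂₃} →
    sqDist P₀ P₁ ≡ d₀₁ → sqDist P₀ P₂ ≡ d₀₂ → sqDist P₀ P₃ ≡ d₀₃ →
    sqDist P₁ P₂ ≡ d₁₂ → sqDist P₁ P₃ ≡ d₁₃ → sqDist P₂ P₃ ≡ d₂₃ →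
    cayleyMenger (+ d₀₁) (+ d₀₂) (+ d₀₃) (+ d₁₂) (+ d₁₃) (+ d₂₃) ≡ 0ℤ
  cayleyMenger-sqDist P₀ P₁ P₂ P₃ refl refl refl refl refl refl = trans
    (congₙ 6 cayleyMenger (+sqDist≡‖‖² P₀ P₁) (+sqDist≡‖‖² P₀ P₂) (+sqDist≡‖‖² P₀ P₃)
                          (+sqDist≡‖‖² P₁ P₂) (+sqDist≡‖‖² P₁ P₃) (+sqDist≡‖‖² P₂ P₃))
    (cayleyMenger-lattice (X P₀) (Y P₀) (X P₁) (Y P₁) (X P₂) (Y P₂) (X P₃) (Y P₃))

  no-equilateral-triangle : ∀ (P Q R : Point m) {a} →
    sqDist P Q ≡ a → sqDist Q R ≡ a → sqDist P R ≡ a → P ≡ Q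
  no-equilateral-triangle P Q R {a} PQ QR PR =
    let k , area = heron-sqDist P Q R PQ PR QR
    in sqDist≡0⇒≡ (trans PQ (x*x≡n*[y*y]⇒∣y∣≡0 squarefree-6 (+ 4 * k) (+ a) (equilateral-heron (+ a) k area)))

  no-square : ∀ (P Q R S : Point m) {a b} →
    sqDist P Q ≡ a → sqDist Q R ≡ a → sqDist R S ≡ a → sqDist P S ≡ a →
    sqDist P R ≡ b → sqDist Q S ≡ b → P ≡ R
  no-square P Q R S {a} {b} PQ QR RS PS PR QS =
    sqDist≡0⇒≡ (trans PR (b≡0 (square-diagonal (+ a) (+ b) (cayleyMenger-sqDist P Q R S PQ PR PS QR QS RS))))
    where
    b≡0 : + b ≡ 0ℤ ⊎ + b ≡ + 2 * + a → b ≡ 0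
    b≡0 (inj₁ +b≡0) = +-injective +b≡0
    b≡0 (inj₂ b≡2a) =
      let k , area = heron-sqDist P Q R PQ PR QR
      in x*x≡n*[y*y]⇒∣y∣≡0 squarefree-2 (+ 4 * k) (+ b) (square-heron (+ a) (+ b) k b≡2a area)

  no-pentagonal-quadruple : ∀ (P Q R S : Point m) {a b} →
    sqDist P Q ≡ a → sqDist Q R ≡ a → sqDist R S ≡ a →
    sqDist P R ≡ b → sqDist Q S ≡ b → sqDist P S ≡ b → P ≡ Q
  no-pentagonal-quadruple P Q R S {a} {b} PQ QR RS PR QS PS =
    sqDist≡0⇒≡ (trans PQ (a≡0 (pentagon-diagonal (+ a) (+ b) (cayleyMenger-sqDist P Q R S PQ PR PS QR QS RS))))
    where
    a≡0 : + a + + b ≡ 0ℤ ⊎ (+ 2 * + b - + 3 * + a) * (+ 2 * + b - + 3 * + a) ≡ + 5 * (+ a * + a) → a ≡ 0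
    a≡0 (inj₁ a+b≡0) = m+n≡0⇒m≡0 a (+-injective a+b≡0)
    a≡0 (inj₂ golden) = x*x≡n*[y*y]⇒∣y∣≡0 squarefree-5 (+ 2 * + b - + 3 * + a) (+ a) golden

module TwoDistanceQuadruples
  {P D : Set} (d : P → P → D) (d-sym : ∀ x y → d x y ≡ d y x)
  (no-equilateral : ∀ x y z {a} → d x y ≡ a → d y z ≡ a → d x z ≡ a → x ≡ y)
  (no-square : ∀ w x y z {a b} → d w x ≡ a → d x y ≡ a → d y z ≡ a → d w z ≡ a →
               d w y ≡ b → d x z ≡ b → w ≡ y)
  (no-pentagonal : ∀ w x y z {a b} → d w x ≡ a → d x y ≡ a → d y z ≡ a →
                   d w y ≡ b → d x z ≡ b → d w z ≡ b → w ≡ x)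
  where

  open import Data.Sum using (swap)

  no-two-distance-quadruple : ∀ {p q r s a b} →
    p ≢ q → p ≢ r → p ≢ s → q ≢ r → q ≢ s → r ≢ s →
    All (TwoValued a b) (d p q ∷ d p r ∷ d p s ∷ d q r ∷ d q s ∷ d r s ∷ []) → ⊥
  no-two-distance-quadruple {p} {q} {r} {s} p≢q p≢r p≢s q≢r q≢s r≢s = two-valued
    where
    flip : ∀ {x y a} → d x y ≡ a → d y x ≡ a
    flip {x} {y} xy = trans (d-sym y x) xy

    go : ∀ {a b} → d p q ≡ a → TwoValued a b (d p r) → TwoValued a b (d p s) →
         TwoValued a b (d q r) → TwoValued a b (d q s) → TwoValued a b (d r s) → ⊥
    go pq (inj₁ pr) _ (inj₁ qr) _ _ = p≢q (no-equilateral p q r pq qr pr)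
    go pq _ (inj₁ ps) _ (inj₁ qs) _ = p≢q (no-equilateral p q s pq qs ps)
    go pq (inj₁ pr) (inj₁ ps) _ _ (inj₁ rs) = p≢r (no-equilateral p r s pr rs ps)
    go pq (inj₂ pr) (inj₂ ps) _ _ (inj₂ rs) = p≢r (no-equilateral p r s pr rs ps)
    go pq _ _ (inj₁ qr) (inj₁ qs) (inj₁ rs) = q≢r (no-equilateral q r s qr rs qs)
    go pq _ _ (inj₂ qr) (inj₂ qs) (inj₂ rs) = q≢r (no-equilateral q r s qr rs qs)
    go pq (inj₁ pr) (inj₂ ps) (inj₂ qr) (inj₁ qs) (inj₁ rs) = p≢s (no-square p q s r pq qs (flip rs) pr ps qr)
    go pq (inj₁ pr) (inj₂ ps) (inj₂ qr) (inj₁ qs) (inj₂ rs) = p≢s (no-pentagonal p s r q ps (flip rs) (flip qr) pr (flip qs) pq)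
    go pq (inj₁ pr) (inj₂ ps) (inj₂ qr) (inj₂ qs) (inj₁ rs) = p≢s (no-pentagonal p s q r ps (flip qs) qr pq (flip rs) pr)
    go pq (inj₂ pr) (inj₁ ps) (inj₁ qr) (inj₂ qs) (inj₁ rs) = p≢r (no-square p q r s pq qr rs ps pr qs)
    go pq (inj₂ pr) (inj₁ ps) (inj₁ qr) (inj₂ qs) (inj₂ rs) = p≢r (no-pentagonal p r s q pr rs (flip qs) ps (flip qr) pq)
    go pq (inj₂ pr) (inj₁ ps) (inj₂ qr) (inj₂ qs) (inj₁ rs) = p≢r (no-pentagonal p r q s pr (flip qr) qs pq rs ps)
    go pq (inj₂ pr) (inj₂ ps) (inj₁ qr) (inj₂ qs) (inj₁ rs) = p≢q (no-pentagonal p q r s pq qr rs pr qs ps)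
    go pq (inj₂ pr) (inj₂ ps) (inj₂ qr) (inj₁ qs) (inj₁ rs) = p≢q (no-pentagonal p q s r pq qs (flip rs) ps qr pr)
    go pq (inj₂ pr) (inj₂ ps) (inj₂ qr) (inj₂ qs) (inj₁ rs) = p≢q (no-square p r q s pr (flip qr) qs ps pq rs)

    two-valued : ∀ {a b} → All (TwoValued a b) (d p q ∷ d p r ∷ d p s ∷ d q r ∷ d q s ∷ d r s ∷ []) → ⊥
    two-valued (inj₁ pq ∷ pr ∷ ps ∷ qr ∷ qs ∷ rs ∷ []) = go pq pr ps qr qs rs
    two-valued (inj₂ pq ∷ pr ∷ ps ∷ qr ∷ qs ∷ rs ∷ []) = go pq (swap pr) (swap ps) (swap qr) (swap qs) (swap rs)

module _ {A : Set} (_≟_ : DecidableEquality A) where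

  at-most-two-values : ∀ {x xs} → x ∈ xs → length (deduplicate _≟_ xs) ≤ 2 →
                       ∃₂ λ a b → All (TwoValued a b) xs
  at-most-two-values x∈xs short =
    let a , b , two = cover (∈-deduplicate⁺ _≟_ x∈xs) short
    in a , b , tabulate (λ y∈xs → two (∈-deduplicate⁺ _≟_ y∈xs))
    where
    cover : ∀ {x us} → x ∈ us → length us ≤ 2 → ∃₂ λ a b → ∀ {y} → y ∈ us → TwoValued a b y
    cover {us = u ∷ []} _ _ = u , u , λ { (here y≡u) → inj₁ y≡u ; (there ()) }
    cover {us = u ∷ v ∷ []} _ _ = u , v , λ { (here y≡u) → inj₁ y≡u ; (there (here y≡v)) → inj₂ y≡v ; (there (there ())) }
    cover {us = _ ∷ _ ∷ _ ∷ _} _ (s≤s (s≤s ()))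

open LatticeGeometry

theorem4p1 : (m : ℕ) → 1 ≤ m → (p q r s : Point m) → p ≢ q → p ≢ r → p ≢ s → q ≢ r → q ≢ s → r ≢ s → 3 ≤ numDistinctDists p q r s
theorem4p1 m _ p q r s p≢q p≢r p≢s q≢r q≢s r≢s =
  decidable-stable (3 ≤? numDistinctDists p q r s) λ fewer-than-three →
    let a , b , two-valued = at-most-two-values _≟_ (here refl) (≤-pred (≰⇒> fewer-than-three))
    in no-two-distance-quadruple p≢q p≢r p≢s q≢r q≢s r≢s two-valued
  where
  open TwoDistanceQuadruples (sqDist {m}) sqDist-sym no-equilateral-triangle no-square no-pentagonal-quadruple
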